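{- Let $\mathcal{L}\in\{\Lambda,\Lambda_{sp}\}$, let $s=\lambda x{:}\alpha.\lambda y{:}\alpha.f(x)$ and $t=\lambda x{:}\alpha.\lambda y{:}\alpha.f(y)$, and let $g=\lambda x.\lambda y.f(r)$ be an $\mathcal{L}$-pattern-derived generalization of $s,t$. Then there is a free variable $Z$ of $g$ of type $\gamma_1\to\cdots\to\gamma_m\to\alpha$ with $m>0$ (each $\gamma_i$ a type) such that $\mathit{head}(r\downarrow_\eta)=Z$.
   Context: Simply-typed $\lambda$-calculus: types are built from base types, including a base type $\alpha$, by $\tau::=\mathcal{B}\mid\tau\to\tau$. Variables are split into free variables ($X,Y,Z,\dots$) and bound variables ($x,y,z,\dots$); constants come from a signature $\Sigma$ containing at least one constant of every type, including $f:\alpha\to\alpha$. Terms are well typed, with no unabstracted bound variables, in $\eta$-long $\beta$-normal form; $\Lambda$ is the set of all terms. ${\sf h}(t_1,\dots,t_m)$ abbreviates iterated application; $\mathit{head}(\lambda x.t')=\lambda x.$, $\mathit{head}({\sf h}(\overline{s_m}))={\sf h}$; $t\downarrow_\eta$ is the $\eta$-normal form. Substitutions map free variables to terms of the same type and are capture-avoiding. A term $t$ is a superpattern if for every subterm whose $\eta$-normal form is $X(s_1,\dots,s_m)$ with $X$ free, each $s_i\downarrow_\eta$ is a bound variable of $t$ or has a free-variable head, and the arguments that are bound variables are pairwise distinct; $\Lambda_{sp}$ is the set of superpatterns. A term $g\in\mathcal{L}$ is an $\mathcal{L}$-generalization of closed terms $s,t$ if $g\sigma_1=_{\alpha\beta\eta}s$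 and $g\sigma_2=_{\alpha\beta\eta}t$ for some substitutions $\sigma_1,\sigma_2$. $g\le_{\mathcal{L}}g'$ iff $g\sigma=_{\alpha\beta\eta}g'$ for some substitution $\sigma$. An $\mathcal{L}$-generalization $g$ of $s,t$ is $\mathcal{L}$-pattern-derived if $\lambda x.\lambda y.f(Z(x,y))\le_{\mathcal{L}}g$, where $Z$ is a free variable of type $\alpha\to\alpha\to\alpha$. -}

module Defs where

open import Data.Nat using (ℕ; zero; suc)
open import Data.Fin using (Fin; zero; suc; punchOut)
open import Data.Fin.Properties using () renaming (_≟_ to _≟F_)
open import Data.List using (List; []; _∷_; foldr)
open import Data.List.Relation.Unary.Unique.Propositional using (Unique)
open import Data.Maybe using (Maybe; just; nothing; maybe)
import Data.Maybe as Maybe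
open import Data.Product using (Σ; ∃; _×_; _,_)
open import Data.Sum using (_⊎_)
open import Data.Unit using (⊤)
open import Relation.Nullary using (yes; no)
open import Relation.Binary.PropositionalEquality using (_≡_)

infixr 30 _⇒_

data Ty (B : Set) : Set where
  base : B → Ty B
  _⇒_  : Ty B → Ty B → Ty B

_⇛_ : {B : Set} → List (Ty B) → Ty B → Ty B
γs ⇛ ρ = foldr _⇒_ ρ γs

module Lambda {B : Set} (Const : Ty B → Set) where

  -- Contexts of bound variables (de Bruijn, so α-equivalence is ≡).
  infixl 25 _▷_
  data Con : Set where
    ∅   : Con
    _▷_ : Con → Ty B → Con

  data Var : Con → Ty B → Set where
    vz : ∀ {Γ σ}   → Var (Γ ▷ σ) σ
    vs : ∀ {Γ σ τ} → Var Γ τ → Var (Γ ▷ σ) τ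

  -- Free variables are pairs (name , type): name ∈ ℕ, so there are
  -- infinitely many free variables of every type.
  data Head (Γ : Con) : Ty B → Set where
    var  : ∀ {τ} → Var Γ τ → Head Γ τ
    con  : ∀ {τ} → Const τ → Head Γ τ
    mvar : ∀ {τ} → ℕ → Head Γ τ

  -- Terms in η-long β-normal form (intrinsically well typed).
  mutual
    data Nf (Γ : Con) : Ty B → Set where
      lam : ∀ {σ τ} → Nf (Γ ▷ σ) τ → Nf Γ (σ ⇒ τ)
      ne  : ∀ {b} → Ne Γ (base b) → Nf Γ (base b)

    data Ne (Γ : Con) : Ty B → Set where
      _∙_ : ∀ {σ ρ} → Head Γ σ → Sp Γ σ ρ → Ne Γ ρ

    data Sp (Γ : Con) : Ty B → Ty B → Set where
      ε   : ∀ {σ} → Sp Γ σ σ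
      _◂_ : ∀ {σ τ ρ} → Nf Γ σ → Sp Γ τ ρ → Sp Γ (σ ⇒ τ) ρ

  infixr 20 _◂_
  infix 15 _∙_

  Term : Ty B → Set
  Term τ = Nf ∅ τ

  Ren : Con → Con → Set
  Ren Γ Δ = ∀ {τ} → Var Γ τ → Var Δ τ

  liftR : ∀ {Γ Δ σ} → Ren Γ Δ → Ren (Γ ▷ σ) (Δ ▷ σ)
  liftR ρ vz     = vz
  liftR ρ (vs x) = vs (ρ x)

  renH : ∀ {Γ Δ τ} → Ren Γ Δ → Head Γ τ → Head Δ τ
  renH ρ (var x)  = var (ρ x)
  renH ρ (con c)  = con c
  renH ρ (mvar n) = mvar n

  mutual
    renNf : ∀ {Γ Δ τ} → Ren Γ Δ → Nf Γ τ → Nf Δ τ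
    renNf ρ (lam t)       = lam (renNf (liftR ρ) t)
    renNf ρ (ne (h ∙ sp)) = ne (renH ρ h ∙ renSp ρ sp)

    renSp : ∀ {Γ Δ σ τ} → Ren Γ Δ → Sp Γ σ τ → Sp Δ σ τ
    renSp ρ ε        = ε
    renSp ρ (t ◂ sp) = renNf ρ t ◂ renSp ρ sp

  fromEmpty : ∀ {Γ} → Ren ∅ Γ
  fromEmpty ()

  -- Hereditary substitution for bound variables (Keller–Altenkirch),
  -- i.e. substitution followed by β-normalisation, staying η-long.

  _-_ : (Γ : Con) → ∀ {σ} → Var Γ σ → Con
  (Γ ▷ σ) - vz   = Γ
  (Γ ▷ τ) - vs x = (Γ - x) ▷ τ

  wkv : ∀ {Γ σ τ} → (x : Var Γ σ) → Var (Γ - x) τ → Var Γ τ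
  wkv vz     y      = vs y
  wkv (vs x) vz     = vz
  wkv (vs x) (vs y) = vs (wkv x y)

  data EqV {Γ : Con} : ∀ {σ τ} → Var Γ σ → Var Γ τ → Set where
    same : ∀ {σ} {x : Var Γ σ} → EqV x x
    diff : ∀ {σ τ} (x : Var Γ σ) (y : Var (Γ - x) τ) → EqV x (wkv x y)

  eqV : ∀ {Γ σ τ} (x : Var Γ σ) (y : Var Γ τ) → EqV x y
  eqV vz     vz     = same
  eqV vz     (vs y) = diff vz y
  eqV (vs x) vz     = diff (vs x) vz
  eqV (vs x) (vs y) with eqV x y
  eqV (vs x) (vs .x)          | same      = same
  eqV (vs x) (vs .(wkv x y')) | diff .x y' = diff (vs x) (vs y')

  mutual
    hsub : ∀ {Γ σ τ} → Nf Γ τ → (x : Var Γ σ) → Nf (Γ - x) σ → Nf (Γ - x) τ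
    hsub (lam t) x u = lam (hsub t (vs x) (renNf vs u))
    hsub (ne (var y ∙ ts)) x u with eqV x y
    hsub (ne (var .x ∙ ts)) x u          | same      = appNf u (hsubSp ts x u)
    hsub (ne (var .(wkv x y') ∙ ts)) x u | diff .x y' = ne (var y' ∙ hsubSp ts x u)
    hsub (ne (con c ∙ ts)) x u  = ne (con c ∙ hsubSp ts x u)
    hsub (ne (mvar n ∙ ts)) x u = ne (mvar n ∙ hsubSp ts x u)

    hsubSp : ∀ {Γ σ τ ρ} → Sp Γ τ ρ → (x : Var Γ σ) → Nf (Γ - x) σ → Sp (Γ - x) τ ρ
    hsubSp ε        x u = ε
    hsubSp (t ◂ ts) x u = hsub t x u ◂ hsubSp ts x u

    appNf : ∀ {Γ σ b} → Nf Γ σ → Sp Γ σ (base b) → Nf Γ (base b)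
    appNf t       ε        = t
    appNf (lam t) (u ◂ ts) = appNf (hsub t vz u) ts

  -- Substitutions for free variables and their application t σ
  -- (the result is the αβη-normal, η-long β-normal form of t σ).

  Subst : Set
  Subst = (n : ℕ) (τ : Ty B) → Term τ

  mutual
    _⟪_⟫ : ∀ {Γ τ} → Nf Γ τ → Subst → Nf Γ τ
    lam t ⟪ θ ⟫                    = lam (t ⟪ θ ⟫)
    ne (var x ∙ sp) ⟪ θ ⟫          = ne (var x ∙ (sp ⟪ θ ⟫s))
    ne (con c ∙ sp) ⟪ θ ⟫          = ne (con c ∙ (sp ⟪ θ ⟫s))
    ne (mvar {τ} n ∙ sp) ⟪ θ ⟫     = appNf (renNf fromEmpty (θ n τ)) (sp ⟪ θ ⟫s)

    _⟪_⟫s : ∀ {Γ σ τ} → Sp Γ σ τ → Subst → Sp Γ σ τ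
    ε ⟪ θ ⟫s        = ε
    (t ◂ sp) ⟪ θ ⟫s = (t ⟪ θ ⟫) ◂ (sp ⟪ θ ⟫s)

  -- Raw (untyped, well-scoped) terms, used to compute η-normal forms

  data Tm (n : ℕ) : Set where
    var : Fin n → Tm n
    con : (τ : Ty B) → Const τ → Tm n
    fv  : ℕ → Ty B → Tm n
    app : Tm n → Tm n → Tm n
    lam : Tm (suc n) → Tm n

  len : Con → ℕ
  len ∅       = zero
  len (Γ ▷ _) = suc (len Γ)

  toFin : ∀ {Γ τ} → Var Γ τ → Fin (len Γ)
  toFin vz     = zero
  toFin (vs x) = suc (toFin x)

  eraseH : ∀ {Γ τ} → Head Γ τ → Tm (len Γ)
  eraseH (var x)        = var (toFin x)
  eraseH (con {τ} c)    = con τ c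
  eraseH (mvar {τ} n)   = fv n τ

  mutual
    erase : ∀ {Γ τ} → Nf Γ τ → Tm (len Γ)
    erase (lam t)       = lam (erase t)
    erase (ne (h ∙ sp)) = eraseSp (eraseH h) sp

    eraseSp : ∀ {Γ σ τ} → Tm (len Γ) → Sp Γ σ τ → Tm (len Γ)
    eraseSp acc ε        = acc
    eraseSp acc (t ◂ sp) = eraseSp (app acc (erase t)) sp

  strV : ∀ {n} → Fin (suc n) → Fin (suc n) → Maybe (Fin n)
  strV i j with i ≟F j
  ... | yes _  = nothing
  ... | no i≢j = just (punchOut i≢j)

  str : ∀ {n} → Fin (suc n) → Tm (suc n) → Maybe (Tm n)
  str i (var j)   = Maybe.map var (strV i j)
  str i (con τ c) = just (con τ c)
  str i (fv m τ)  = just (fv m τ)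
  str i (app u v) = Maybe.ap (Maybe.map app (str i u)) (str i v)
  str i (lam b)   = Maybe.map lam (str (suc i) b)

  -- one top-level η-step on λ.b, where b is already η-normal
  etaLam : ∀ {n} → Tm (suc n) → Tm n
  etaLam (app u (var zero)) = maybe (λ u′ → u′) (lam (app u (var zero))) (str zero u)
  etaLam b                  = lam b

  η↓ : ∀ {n} → Tm n → Tm n
  η↓ (var i)   = var i
  η↓ (con τ c) = con τ c
  η↓ (fv m τ)  = fv m τ
  η↓ (app u v) = app (η↓ u) (η↓ v)
  η↓ (lam b)   = etaLam (η↓ b)

  data RHead (n : ℕ) : Set where
    lamH : RHead n
    varH : Fin n → RHead n
    conH : (τ : Ty B) → Const τ → RHead n
    fvH  : ℕ → Ty B → RHead n

  head : ∀ {n} → Tm n → RHead n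
  head (var i)   = varH i
  head (con τ c) = conH τ c
  head (fv m τ)  = fvH m τ
  head (app u v) = head u
  head (lam b)   = lamH

  asVar : ∀ {n} → Tm n → Maybe (Fin n)
  asVar (var i) = just i
  asVar _       = nothing

  ArgOK : ∀ {Γ σ} → Nf Γ σ → Set
  ArgOK s = (∃ λ i → η↓ (erase s) ≡ var i)
          ⊎ (∃ λ m → ∃ λ τ → head (η↓ (erase s)) ≡ fvH m τ)

  AllArgsOK : ∀ {Γ σ τ} → Sp Γ σ τ → Set
  AllArgsOK ε        = ⊤
  AllArgsOK (s ◂ sp) = ArgOK s × AllArgsOK sp

  boundArgs : ∀ {Γ σ τ} → Sp Γ σ τ → List (Fin (len Γ))
  boundArgs ε        = []
  boundArgs (s ◂ sp) with asVar (η↓ (erase s))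
  ... | just i  = i ∷ boundArgs sp
  ... | nothing = boundArgs sp

  mutual
    SuperPattern : ∀ {Γ τ} → Nf Γ τ → Set
    SuperPattern (lam t)          = SuperPattern t
    SuperPattern (ne (var x ∙ sp)) = SPSp sp
    SuperPattern (ne (con c ∙ sp)) = SPSp sp
    SuperPattern (ne (mvar n ∙ sp)) =
      AllArgsOK sp × Unique (boundArgs sp) × SPSp sp

    SPSp : ∀ {Γ σ τ} → Sp Γ σ τ → Set
    SPSp ε        = ⊤
    SPSp (s ◂ sp) = SuperPattern s × SPSp sp

  data Language : Set where
    Λ Λsp : Language

  _∈L_ : ∀ {τ} → Term τ → Language → Set
  t ∈L Λ   = ⊤
  t ∈L Λsp = SuperPattern t

  IsGeneralization : ∀ {τ} → Language → Term τ → Term τ → Term τ → Set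
  IsGeneralization 𝓛 g s t =
    g ∈L 𝓛 × (∃ λ (θ₁ : Subst) → g ⟪ θ₁ ⟫ ≡ s) × (∃ λ (θ₂ : Subst) → g ⟪ θ₂ ⟫ ≡ t)

  _≤[_]_ : ∀ {τ} → Term τ → Language → Term τ → Set
  g ≤[ 𝓛 ] g′ = ∃ λ (θ : Subst) → g ⟪ θ ⟫ ≡ g′

  module Example (α : B) (f : Const (base α ⇒ base α)) where

    A : Ty B
    A = base α

    Γxy : Con
    Γxy = ∅ ▷ A ▷ A

    x y : Nf Γxy A
    x = ne (var (vs vz) ∙ ε)
    y = ne (var vz ∙ ε)

    λxy-f : Nf Γxy A → Term (A ⇒ A ⇒ A)
    λxy-f r = lam (lam (ne (con f ∙ r ◂ ε)))

    s t : Term (A ⇒ A ⇒ A)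
    s = λxy-f x
    t = λxy-f y

    patTerm : Term (A ⇒ A ⇒ A)
    patTerm = λxy-f (ne (mvar {τ = A ⇒ A ⇒ A} 0 ∙ x ◂ y ◂ ε))

    PatternDerived : Language → Term (A ⇒ A ⇒ A) → Set
    PatternDerived 𝓛 g = patTerm ≤[ 𝓛 ] g

-- Both x and y are instances of r. A substitution for free variables keeps a bound
-- variable or constant head, so r cannot be rigid: it would then have to equal x and y
-- at once. Hence its head is a free variable Z, and Z must take arguments, because
-- instantiating a bare Z yields a closed term, which is never the bound variable x.
-- Finally, η-normalisation leaves the head of an application unchanged.
module Submission where

open import Defs
open import Data.Nat using (ℕ; _>_; s≤s; z≤n)
open import Data.List using (List; length; []; _∷_)
open import Data.Product using (∃; _×_; _,_)
open import Data.Empty using (⊥-elim)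
open import Relation.Binary.PropositionalEquality using (_≡_; _≢_; refl; cong; trans)

module _ {B : Set} {Const : Ty B → Set} where
  open Lambda Const

  argTys : ∀ {Γ σ ρ} → Sp Γ σ ρ → List (Ty B)
  argTys ε                = []
  argTys (_◂_ {σ} _ sp) = σ ∷ argTys sp

  Sp-type : ∀ {Γ σ ρ} (sp : Sp Γ σ ρ) → σ ≡ argTys sp ⇛ ρ
  Sp-type ε                = refl
  Sp-type (_◂_ {σ} _ sp) = cong (σ ⇒_) (Sp-type sp)

  head-η↓-eraseSp : ∀ {Γ σ τ} (acc : Tm (len Γ)) (sp : Sp Γ σ τ) →
                    head (η↓ (eraseSp acc sp)) ≡ head (η↓ acc)
  head-η↓-eraseSp acc ε        = refl
  head-η↓-eraseSp acc (t ◂ sp) = head-η↓-eraseSp (app acc (erase t)) sp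

  HasFlexHeadWithArgs : ∀ {Γ b} → Nf Γ (base b) → Set
  HasFlexHeadWithArgs {b = b} r =
    ∃ λ (Z : ℕ) → ∃ λ (γs : List (Ty B)) →
      length γs > 0 × head (η↓ (erase r)) ≡ fvH Z (γs ⇛ base b)

  flex-hasFlexHeadWithArgs : ∀ {Γ b σ τ} (Z : ℕ) (t : Nf Γ σ) (sp : Sp Γ τ (base b)) →
                             HasFlexHeadWithArgs (ne (mvar Z ∙ t ◂ sp))
  flex-hasFlexHeadWithArgs {σ = σ} {τ} Z t sp =
    Z , σ ∷ argTys sp , s≤s z≤n ,
    trans (head-η↓-eraseSp (app (fv Z (σ ⇒ τ)) (erase t)) sp)
          (cong (fvH Z) (Sp-type (t ◂ sp)))

  weakened-closed-≢-var : ∀ {Γ b} (u : Term (base b)) (v : Var Γ (base b)) →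
                          renNf fromEmpty u ≢ ne (var v ∙ ε)
  weakened-closed-≢-var (ne (var () ∙ _))  _
  weakened-closed-≢-var (ne (con _ ∙ _))  _ ()
  weakened-closed-≢-var (ne (mvar _ ∙ _)) _ ()

  instance-of-two-vars⇒hasFlexHeadWithArgs :
    ∀ {Γ b} {v₁ v₂ : Var Γ (base b)} → v₁ ≢ v₂ → (r : Nf Γ (base b)) →
    (∃ λ θ₁ → r ⟪ θ₁ ⟫ ≡ ne (var v₁ ∙ ε)) →
    (∃ λ θ₂ → r ⟪ θ₂ ⟫ ≡ ne (var v₂ ∙ ε)) →
    HasFlexHeadWithArgs r
  instance-of-two-vars⇒hasFlexHeadWithArgs v₁≢v₂ (ne (var _ ∙ ε)) (_ , refl) (_ , refl) =
    ⊥-elim (v₁≢v₂ refl)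
  instance-of-two-vars⇒hasFlexHeadWithArgs _ (ne (con _ ∙ _)) (_ , ()) _
  instance-of-two-vars⇒hasFlexHeadWithArgs {b = b} {v₁} _ (ne (mvar Z ∙ ε)) (θ₁ , e) _ =
    ⊥-elim (weakened-closed-≢-var (θ₁ Z (base b)) v₁ e)
  instance-of-two-vars⇒hasFlexHeadWithArgs _ (ne (mvar Z ∙ t ◂ sp)) _ _ =
    flex-hasFlexHeadWithArgs Z t sp

  module _ {α : B} {f : Const (base α ⇒ base α)} where
    open Example α f

    λxy-f-injective : ∀ {r r′ : Nf Γxy A} → λxy-f r ≡ λxy-f r′ → r ≡ r′
    λxy-f-injective refl = refl

    x≢y : vs vz ≢ vz {∅ ▷ A}
    x≢y ()

mainTheorem2 : (B : Set) (Const : Ty B → Set) (α : B)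
    (f : Const (base α ⇒ base α))
    (everyTypeInhabited : (τ : Ty B) → Const τ)
    (𝓛 : Lambda.Language Const)
    (r : Lambda.Nf Const (Lambda.Example.Γxy Const α f) (base α)) →
    let g = Lambda.Example.λxy-f Const α f r in
    Lambda.IsGeneralization Const 𝓛 g
      (Lambda.Example.s Const α f) (Lambda.Example.t Const α f) →
    Lambda.Example.PatternDerived Const α f 𝓛 g →
    ∃ λ (Z : ℕ) → ∃ λ (γs : List (Ty B)) →
      length γs > 0 ×
      Lambda.head Const (Lambda.η↓ Const (Lambda.erase Const r))
        ≡ Lambda.fvH Z (γs ⇛ base α)
mainTheorem2 _ _ _ f _ _ r (_ , (θ₁ , g≤s) , (θ₂ , g≤t)) _ =
  instance-of-two-vars⇒hasFlexHeadWithArgs (x≢y {f = f}) r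
    (θ₁ , λxy-f-injective g≤s) (θ₂ , λxy-f-injective g≤t)
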